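{- Let $k=3$ and, for $n\ge1$, let $a_3^{(2n)}$ and $a_4^{(2n)}$ denote the coefficients of $x^3$ and $x^4$ in the independence polynomial $I(\bar A_{2n};x)$ of the antiregular $3$-hypergraph $\bar A_{2n}$. Then $$a_3^{(2n)}=\tfrac16 n(n-1)(4n+1),\qquad a_4^{(2n)}=\tfrac16 n^2(n-1)(n-2).$$
   Context: All hypergraphs are $3$-uniform. For a binary string $b=b_1\cdots b_m$, $H(b)$ is the $3$-uniform hypergraph on $\{1,\dots,m\}$ in which a $3$-subset is a hyperedge iff its largest element $j$ satisfies $b_j=1$. For $m\le 2$, $\bar A_m$ is the edgeless hypergraph on $m$ vertices; for $m\ge 3$, $\bar A_m=H(b)$ with $b$ of length $m$, $b_1=b_2=0$, $b_3,\dots,b_m$ alternating, and $b_m=0$. A vertex set is independent if it contains no hyperedge, and $I(H;x)=\sum_{W\text{ independent}}x^{|W|}$. -}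

module Defs where

open import Data.Bool using (Bool; true; false; _∧_; _∨_; not; if_then_else_)
open import Data.Nat using (ℕ; zero; suc; _+_; _<ᵇ_; _≡ᵇ_; _%_)
open import Data.Fin using (Fin; toℕ)
open import Data.Fin.Subset using (Subset; ∣_∣)
open import Data.Vec using (Vec; []; _∷_; lookup)
open import Data.List using (List; []; _∷_; map; _++_; allFin; foldr; length; filterᵇ)

-- Vertices {1,…,m} are represented by Fin m (vertex i+1 ↔ index i).
-- A binary string b = b_1⋯b_m is a function Fin m → Bool (b (i) = b_{i+1}).

isEdge : {m : ℕ} → (Fin m → Bool) → Fin m → Fin m → Fin m → Bool
isEdge b i j k = (toℕ i <ᵇ toℕ j) ∧ (toℕ j <ᵇ toℕ k) ∧ b k

allᵇ : {A : Set} → (A → Bool) → List A → Bool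
allᵇ p = foldr (λ x r → p x ∧ r) true

independent : {m : ℕ} → (Fin m → Bool) → Subset m → Bool
independent {m} b W =
  allᵇ (λ i → allᵇ (λ j → allᵇ (λ k →
    not (lookup W i ∧ lookup W j ∧ lookup W k ∧ isEdge b i j k))
      (allFin m)) (allFin m)) (allFin m)

allSubsets : (m : ℕ) → List (Subset m)
allSubsets zero = [] ∷ []
allSubsets (suc m) = map (true ∷_) (allSubsets m) ++ map (false ∷_) (allSubsets m)

indepCoeff : {m : ℕ} → (Fin m → Bool) → ℕ → ℕ
indepCoeff {m} b t =
  length (filterᵇ (λ W → (∣ W ∣ ≡ᵇ t) ∧ independent b W) (allSubsets m))

-- The antiregular string of length m (m ≥ 3): b_1 = b_2 = 0, b_3,…,b_m
-- alternating, b_m = 0; i.e. for j ≥ 3, b_j = 1 iff j ≢ m (mod 2).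
-- For m ≤ 2 it is all zeros, giving the edgeless hypergraph, as in the paper.
antiBit : (m : ℕ) → Fin m → Bool
antiBit m i = (2 <ᵇ suc (toℕ i)) ∧ not (((suc (toℕ i)) % 2) ≡ᵇ (m % 2))

antiCoeff : ℕ → ℕ → ℕ
antiCoeff m t = indepCoeff (antiBit m) t

-- An edge of H(b) is determined by its largest vertex, so W is independent iff
-- every element of W other than its two smallest has bit 0.  Peeling off the
-- least vertex, the number of such t-sets satisfies a recurrence linking three
-- levels: all elements of W have bit 0, all but the least do, all but the two
-- least do.  For Ā_{2n} the bit string is 0 0 (1 0)^(n-1); on the strings
-- (1 0)^l the recurrence is solved in closed form by induction on l.
module Submission where

open import Defs
open import Data.Nat using (ℕ; zero; suc; _*_; _+_; _∸_; _≥_; _<ᵇ_; _≡ᵇ_; _%_)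
open import Data.Nat.Properties using (*-comm; *-suc; +-cancelʳ-≡)
open import Data.Nat.DivMod using (m*n%n≡0)
open import Data.Nat.Tactic.RingSolver using (solve)
open import Data.Bool using (Bool; true; false; _∧_; _∨_; not; if_then_else_)
open import Data.Bool.Properties using (∧-zeroʳ; ∧-idem)
open import Data.Fin using (Fin; toℕ; zero; suc)
open import Data.Fin.Subset using (Subset; ∣_∣)
open import Data.Vec using (_∷_; []; lookup)
open import Data.List as List using (List; []; _∷_; tabulate; applyUpTo; allFin; length; filterᵇ; map; _++_)
open import Data.List.Properties using (tabulate-cong; length-++; filter-++; filter-none)
open import Relation.Nullary.Decidable using (T?)
open import Data.List.Relation.Unary.All using (universal)
open import Data.Product using (_×_; _,_)
open import Function using (_∘_; id)
open import Relation.Binary.PropositionalEquality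
  using (_≡_; _≗_; refl; cong; cong₂; trans; module ≡-Reasoning)
open ≡-Reasoning

allFinᵇ : {m : ℕ} → (Fin m → Bool) → Bool
allFinᵇ {zero}  p = true
allFinᵇ {suc m} p = p zero ∧ allFinᵇ (p ∘ suc)

allᵇ-tabulate : {A : Set} {m : ℕ} (p : A → Bool) (f : Fin m → A) →
                allᵇ p (tabulate f) ≡ allFinᵇ (p ∘ f)
allᵇ-tabulate {m = zero}  p f = refl
allᵇ-tabulate {m = suc m} p f = cong (p (f zero) ∧_) (allᵇ-tabulate p (f ∘ suc))

allᵇ-allFin : ∀ m {p : Fin m → Bool} → allᵇ p (allFin m) ≡ allFinᵇ p
allᵇ-allFin m {p} = allᵇ-tabulate p id

allFinᵇ-cong : {m : ℕ} {p q : Fin m → Bool} → p ≗ q → allFinᵇ p ≡ allFinᵇ q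
allFinᵇ-cong {zero}  e = refl
allFinᵇ-cong {suc m} e = cong₂ _∧_ (e zero) (allFinᵇ-cong (e ∘ suc))

allFinᵇ-true : {m : ℕ} {p : Fin m → Bool} → (∀ i → p i ≡ true) → allFinᵇ p ≡ true
allFinᵇ-true {m} e = trans (allFinᵇ-cong e) (const-true m)
  where
  const-true : ∀ m → allFinᵇ {m} (λ _ → true) ≡ true
  const-true zero    = refl
  const-true (suc m) = const-true m

∧-unitˡ : ∀ {a b} → a ≡ true → a ∧ b ≡ b
∧-unitˡ refl = refl

not-∧-false₂ : ∀ a b → not (a ∧ b ∧ false) ≡ true
not-∧-false₂ false b     = refl
not-∧-false₂ true  false = refl
not-∧-false₂ true  true  = refl

not-∧-false₃ : ∀ a b c → not (a ∧ b ∧ c ∧ false) ≡ true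
not-∧-false₃ false b c = refl
not-∧-false₃ true  b c = not-∧-false₂ b c

-- independentᵣ c W: W is independent in the r-uniform analogue of H(c).
independent₁ : {m : ℕ} → (Fin m → Bool) → Subset m → Bool
independent₁ c W = allFinᵇ λ k → not (lookup W k ∧ c k)

independent₂ : {m : ℕ} → (Fin m → Bool) → Subset m → Bool
independent₂ c W = allFinᵇ λ j → allFinᵇ λ k →
  not (lookup W j ∧ lookup W k ∧ ((toℕ j <ᵇ toℕ k) ∧ c k))

independent₃ : {m : ℕ} → (Fin m → Bool) → Subset m → Bool
independent₃ b W = allFinᵇ λ i → allFinᵇ λ j → allFinᵇ λ k →
  not (lookup W i ∧ lookup W j ∧ lookup W k ∧ isEdge b i j k)

independent≡independent₃ : {m : ℕ} (b : Fin m → Bool) (W : Subset m) →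
                           independent b W ≡ independent₃ b W
independent≡independent₃ {m} b W =
  trans (allᵇ-allFin m) (allFinᵇ-cong {m} λ i →
  trans (allᵇ-allFin m) (allFinᵇ-cong {m} λ j →
  allᵇ-allFin m))

allFinᵇ²-not-∧ : {m : ℕ} (x : Bool) (R : Fin m → Fin m → Bool) →
                 allFinᵇ (λ j → allFinᵇ λ k → not (x ∧ R j k))
                 ≡ (not x ∨ allFinᵇ λ j → allFinᵇ λ k → not (R j k))
allFinᵇ²-not-∧ {m} false R = allFinᵇ-true {m} λ j → allFinᵇ-true {m} λ k → refl
allFinᵇ²-not-∧ true  R = refl

independent₂-∷ : {m : ℕ} (c : Fin (suc m) → Bool) (x : Bool) (W : Subset m) →
                 independent₂ c (x ∷ W)
                 ≡ (not x ∨ independent₁ (c ∘ suc) W) ∧ independent₂ (c ∘ suc) W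
independent₂-∷ {m} c x W = cong₂ _∧_ (least x)
  (allFinᵇ-cong λ j → ∧-unitˡ (not-∧-false₂ (lookup W j) x))
  where
  least : ∀ x → not (x ∧ x ∧ false) ∧ allFinᵇ (λ k → not (x ∧ lookup W k ∧ c (suc k)))
                ≡ (not x ∨ independent₁ (c ∘ suc) W)
  least false = allFinᵇ-true {m} λ k → refl
  least true  = refl

independent₃-∷ : {m : ℕ} (b : Fin (suc m) → Bool) (x : Bool) (W : Subset m) →
                 independent₃ b (x ∷ W)
                 ≡ (not x ∨ independent₂ (b ∘ suc) W) ∧ independent₃ (b ∘ suc) W
independent₃-∷ b x W = cong₂ _∧_
  (trans (cong₂ _∧_ (allFinᵇ-true λ k → not-∧-false₃ x x (lookup (x ∷ W) k))
                    (allFinᵇ-cong λ j → ∧-unitˡ (not-∧-false₃ x (lookup W j) x)))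
         (allFinᵇ²-not-∧ x λ j k → lookup W j ∧ lookup W k ∧ ((toℕ j <ᵇ toℕ k) ∧ b (suc k))))
  (allFinᵇ-cong λ i → cong₂ _∧_
    (allFinᵇ-true λ k → not-∧-false₃ (lookup W i) x (lookup (x ∷ W) k))
    (allFinᵇ-cong λ j → ∧-unitˡ
      (trans (cong (λ e → not (lookup W i ∧ lookup W j ∧ x ∧ e)) (∧-zeroʳ (toℕ i <ᵇ toℕ j)))
             (not-∧-false₃ (lookup W i) (lookup W j) x))))

zerosBeyond : {m : ℕ} → ℕ → (Fin m → Bool) → Subset m → Bool
zerosBeyond r       b []          = true
zerosBeyond r       b (false ∷ W) = zerosBeyond r (b ∘ suc) W
zerosBeyond zero    b (true ∷ W)  = not (b zero) ∧ zerosBeyond zero (b ∘ suc) W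
zerosBeyond (suc r) b (true ∷ W)  = zerosBeyond r (b ∘ suc) W

zerosBeyond-∧-suc : {m : ℕ} (r : ℕ) (b : Fin m → Bool) (W : Subset m) →
                    zerosBeyond r b W ∧ zerosBeyond (suc r) b W ≡ zerosBeyond r b W
zerosBeyond-∧-suc r       b []          = refl
zerosBeyond-∧-suc r       b (false ∷ W) = zerosBeyond-∧-suc r (b ∘ suc) W
zerosBeyond-∧-suc zero    b (true ∷ W) with b zero
... | true  = refl
... | false = ∧-idem (zerosBeyond zero (b ∘ suc) W)
zerosBeyond-∧-suc (suc r) b (true ∷ W)  = zerosBeyond-∧-suc r (b ∘ suc) W

independent₁≡zerosBeyond₀ : {m : ℕ} (c : Fin m → Bool) (W : Subset m) →
                            independent₁ c W ≡ zerosBeyond 0 c W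
independent₁≡zerosBeyond₀ c []          = refl
independent₁≡zerosBeyond₀ c (false ∷ W) = independent₁≡zerosBeyond₀ (c ∘ suc) W
independent₁≡zerosBeyond₀ c (true ∷ W)  = cong (not (c zero) ∧_) (independent₁≡zerosBeyond₀ (c ∘ suc) W)

independent₂≡zerosBeyond₁ : {m : ℕ} (c : Fin m → Bool) (W : Subset m) →
                            independent₂ c W ≡ zerosBeyond 1 c W
independent₂≡zerosBeyond₁ c []          = refl
independent₂≡zerosBeyond₁ c (false ∷ W) =
  trans (independent₂-∷ c false W) (independent₂≡zerosBeyond₁ (c ∘ suc) W)
independent₂≡zerosBeyond₁ c (true ∷ W)  = begin
  independent₂ c (true ∷ W)                            ≡⟨ independent₂-∷ c true W ⟩
  independent₁ (c ∘ suc) W ∧ independent₂ (c ∘ suc) W  ≡⟨ cong₂ _∧_ (independent₁≡zerosBeyond₀ (c ∘ suc) W)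
                                                                   (independent₂≡zerosBeyond₁ (c ∘ suc) W) ⟩
  zerosBeyond 0 (c ∘ suc) W ∧ zerosBeyond 1 (c ∘ suc) W ≡⟨ zerosBeyond-∧-suc 0 (c ∘ suc) W ⟩
  zerosBeyond 0 (c ∘ suc) W                            ∎

independent₃≡zerosBeyond₂ : {m : ℕ} (b : Fin m → Bool) (W : Subset m) →
                            independent₃ b W ≡ zerosBeyond 2 b W
independent₃≡zerosBeyond₂ b []          = refl
independent₃≡zerosBeyond₂ b (false ∷ W) =
  trans (independent₃-∷ b false W) (independent₃≡zerosBeyond₂ (b ∘ suc) W)
independent₃≡zerosBeyond₂ b (true ∷ W)  = begin
  independent₃ b (true ∷ W)                            ≡⟨ independent₃-∷ b true W ⟩
  independent₂ (b ∘ suc) W ∧ independent₃ (b ∘ suc) W  ≡⟨ cong₂ _∧_ (independent₂≡zerosBeyond₁ (b ∘ suc) W)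
                                                                   (independent₃≡zerosBeyond₂ (b ∘ suc) W) ⟩
  zerosBeyond 1 (b ∘ suc) W ∧ zerosBeyond 2 (b ∘ suc) W ≡⟨ zerosBeyond-∧-suc 1 (b ∘ suc) W ⟩
  zerosBeyond 1 (b ∘ suc) W                            ∎

countSubsets : (m : ℕ) → (Subset m → Bool) → ℕ
countSubsets m p = length (filterᵇ p (allSubsets m))

length-filterᵇ-map : {A B : Set} (p : B → Bool) (f : A → B) (xs : List A) →
                     length (filterᵇ p (map f xs)) ≡ length (filterᵇ (p ∘ f) xs)
length-filterᵇ-map p f []       = refl
length-filterᵇ-map p f (x ∷ xs) with p (f x)
... | true  = cong suc (length-filterᵇ-map p f xs)
... | false = length-filterᵇ-map p f xs

filterᵇ-cong : {A : Set} {p q : A → Bool} → p ≗ q → filterᵇ p ≗ filterᵇ q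
filterᵇ-cong         e []       = refl
filterᵇ-cong {q = q} e (x ∷ xs) rewrite e x with q x
... | true  = cong (x ∷_) (filterᵇ-cong e xs)
... | false = filterᵇ-cong e xs

countSubsets-cong : (m : ℕ) {p q : Subset m → Bool} → p ≗ q → countSubsets m p ≡ countSubsets m q
countSubsets-cong m e = cong length (filterᵇ-cong e (allSubsets m))

countSubsets-none : (m : ℕ) {p : Subset m → Bool} → (∀ W → p W ≡ false) → countSubsets m p ≡ 0
countSubsets-none m e = trans (countSubsets-cong m e)
  (cong length (filter-none (T? ∘ λ _ → false) (universal (λ _ ()) (allSubsets m))))

countSubsets-∷ : (m : ℕ) (p : Subset (suc m) → Bool) →
                 countSubsets (suc m) p ≡ countSubsets m (p ∘ (true ∷_)) + countSubsets m (p ∘ (false ∷_))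
countSubsets-∷ m p = begin
  length (filterᵇ p (map (true ∷_) S ++ map (false ∷_) S))
    ≡⟨ cong length (filter-++ (T? ∘ p) (map (true ∷_) S) (map (false ∷_) S)) ⟩
  length (filterᵇ p (map (true ∷_) S) ++ filterᵇ p (map (false ∷_) S))
    ≡⟨ length-++ (filterᵇ p (map (true ∷_) S)) ⟩
  length (filterᵇ p (map (true ∷_) S)) + length (filterᵇ p (map (false ∷_) S))
    ≡⟨ cong₂ _+_ (length-filterᵇ-map p (true ∷_) S) (length-filterᵇ-map p (false ∷_) S) ⟩
  countSubsets m (p ∘ (true ∷_)) + countSubsets m (p ∘ (false ∷_)) ∎
  where S = allSubsets m

countZerosBeyond : ℕ → List Bool → ℕ → ℕ
countZerosBeyond r       bs       zero    = 1
countZerosBeyond r       []       (suc t) = 0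
countZerosBeyond zero    (c ∷ bs) (suc t) =
  (if c then 0 else countZerosBeyond zero bs t) + countZerosBeyond zero bs (suc t)
countZerosBeyond (suc r) (c ∷ bs) (suc t) =
  countZerosBeyond r bs t + countZerosBeyond (suc r) bs (suc t)

countSubsets-zerosBeyond : {m : ℕ} (r : ℕ) (b : Fin m → Bool) (t : ℕ) →
  countSubsets m (λ W → (∣ W ∣ ≡ᵇ t) ∧ zerosBeyond r b W) ≡ countZerosBeyond r (tabulate b) t
countSubsets-zerosBeyond {zero}  r b zero    = refl
countSubsets-zerosBeyond {zero}  r b (suc t) = refl
countSubsets-zerosBeyond {suc m} r b zero =
  trans (countSubsets-∷ m _) (cong₂ _+_ (countSubsets-none m λ W → refl) (countSubsets-zerosBeyond r (b ∘ suc) zero))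
countSubsets-zerosBeyond {suc m} zero b (suc t) =
  trans (countSubsets-∷ m _) (cong₂ _+_ (least (b zero)) (countSubsets-zerosBeyond zero (b ∘ suc) (suc t)))
  where
  least : ∀ c → countSubsets m (λ W → (∣ W ∣ ≡ᵇ t) ∧ (not c ∧ zerosBeyond zero (b ∘ suc) W))
                ≡ (if c then 0 else countZerosBeyond zero (tabulate (b ∘ suc)) t)
  least true  = countSubsets-none m λ W → ∧-zeroʳ (∣ W ∣ ≡ᵇ t)
  least false = countSubsets-zerosBeyond zero (b ∘ suc) t
countSubsets-zerosBeyond {suc m} (suc r) b (suc t) =
  trans (countSubsets-∷ m _)
        (cong₂ _+_ (countSubsets-zerosBeyond r (b ∘ suc) t) (countSubsets-zerosBeyond (suc r) (b ∘ suc) (suc t)))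

indepCoeff≡countZerosBeyond : {m : ℕ} (b : Fin m → Bool) (t : ℕ) →
  indepCoeff b t ≡ countZerosBeyond 2 (tabulate b) t
indepCoeff≡countZerosBeyond {m} b t = trans
  (countSubsets-cong m λ W →
    cong ((∣ W ∣ ≡ᵇ t) ∧_) (trans (independent≡independent₃ b W) (independent₃≡zerosBeyond₂ b W)))
  (countSubsets-zerosBeyond 2 b t)

alternating : ℕ → List Bool
alternating zero    = []
alternating (suc l) = true ∷ false ∷ alternating l

tabulate-toℕ : {n : ℕ} (f : ℕ → Bool) → tabulate {n = n} (f ∘ toℕ) ≡ applyUpTo f n
tabulate-toℕ {zero}  f = refl
tabulate-toℕ {suc n} f = cong (f 0 ∷_) (tabulate-toℕ (f ∘ suc))

tabulate-antiBit : ∀ k → tabulate (antiBit (2 * suc k)) ≡ false ∷ false ∷ alternating k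
tabulate-antiBit k = begin
  tabulate (antiBit (2 * suc k))
    ≡⟨ tabulate-cong (λ i → cong (λ p → antiBitℕ p (toℕ i)) (even%2 (suc k))) ⟩
  tabulate (antiBitℕ 0 ∘ toℕ)
    ≡⟨ tabulate-toℕ (antiBitℕ 0) ⟩
  applyUpTo (antiBitℕ 0) (2 * suc k)
    ≡⟨ cong (applyUpTo (antiBitℕ 0)) (*-suc 2 k) ⟩
  false ∷ false ∷ applyUpTo oddVertex (2 * k)
    ≡⟨ cong (λ bs → false ∷ false ∷ bs) (applyUpTo-oddVertex k) ⟩
  false ∷ false ∷ alternating k ∎
  where
  antiBitℕ : ℕ → ℕ → Bool
  antiBitℕ p j = (2 <ᵇ suc j) ∧ not ((suc j % 2) ≡ᵇ p)
  even%2 : ∀ n → (2 * n) % 2 ≡ 0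
  even%2 n = trans (cong (_% 2) (*-comm 2 n)) (m*n%n≡0 n 2)
  oddVertex : ℕ → Bool
  oddVertex j = not ((suc j % 2) ≡ᵇ 0)
  -- suc (suc j) % 2 and j % 2 are definitionally equal.
  applyUpTo-oddVertex : ∀ k → applyUpTo oddVertex (2 * k) ≡ alternating k
  applyUpTo-oddVertex zero    = refl
  applyUpTo-oddVertex (suc k) =
    trans (cong (applyUpTo oddVertex) (*-suc 2 k)) (cong (λ bs → true ∷ false ∷ bs) (applyUpTo-oddVertex k))

alternating-0-1 : ∀ l → countZerosBeyond 0 (alternating l) 1 ≡ l
alternating-0-1 zero    = refl
alternating-0-1 (suc l) = cong suc (alternating-0-1 l)

-- The closed forms are multiplied out so that no subtraction or division occurs.
alternating-0-2 : ∀ l → 2 * countZerosBeyond 0 (alternating l) 2 + l ≡ l * l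
alternating-0-2 zero    = refl
alternating-0-2 (suc l) = step (alternating-0-1 l) (alternating-0-2 l)
  where
  step : ∀ {x₁ x₂} → x₁ ≡ l → 2 * x₂ + l ≡ l * l → 2 * (x₁ + x₂) + suc l ≡ suc l * suc l
  step {x₂ = x₂} refl ih = begin
    2 * (l + x₂) + suc l       ≡⟨ solve (l List.∷ x₂ List.∷ List.[]) ⟩
    (2 * x₂ + l) + (2 * l + 1) ≡⟨ cong (_+ (2 * l + 1)) ih ⟩
    l * l + (2 * l + 1)        ≡⟨ solve (l List.∷ List.[]) ⟩
    suc l * suc l              ∎

alternating-1-2 : ∀ l → countZerosBeyond 1 (alternating l) 2 ≡ l * l
alternating-1-2 zero    = refl
alternating-1-2 (suc l) = step (alternating-0-1 l) (alternating-1-2 l)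
  where
  step : ∀ {x₁ y₂} → x₁ ≡ l → y₂ ≡ l * l → suc x₁ + (x₁ + y₂) ≡ suc l * suc l
  step refl refl = solve (l List.∷ List.[])

alternating-1-3 : ∀ l → 6 * countZerosBeyond 1 (alternating l) 3 + 3 * (l * l) ≡ 2 * (l * l * l) + l
alternating-1-3 zero    = refl
alternating-1-3 (suc l) = step (alternating-0-1 l) (alternating-0-2 l) (alternating-1-3 l)
  where
  step : ∀ {x₁ x₂ y₃} → x₁ ≡ l → 2 * x₂ + l ≡ l * l → 6 * y₃ + 3 * (l * l) ≡ 2 * (l * l * l) + l →
         6 * ((x₁ + x₂) + (x₂ + y₃)) + 3 * (suc l * suc l) ≡ 2 * (suc l * suc l * suc l) + suc l
  step {x₂ = x₂} {y₃} refl ih₂ ih₃ = begin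
    6 * ((l + x₂) + (x₂ + y₃)) + 3 * (suc l * suc l)
      ≡⟨ solve (l List.∷ x₂ List.∷ y₃ List.∷ List.[]) ⟩
    (6 * y₃ + 3 * (l * l)) + 6 * (2 * x₂ + l) + (6 * l + 3)
      ≡⟨ cong₂ (λ a b → a + 6 * b + (6 * l + 3)) ih₃ ih₂ ⟩
    (2 * (l * l * l) + l) + 6 * (l * l) + (6 * l + 3)
      ≡⟨ solve (l List.∷ List.[]) ⟩
    2 * (suc l * suc l * suc l) + suc l ∎

alternating-2-3 : ∀ l → 6 * countZerosBeyond 2 (alternating l) 3 + (3 * (l * l) + l) ≡ 4 * (l * l * l)
alternating-2-3 zero    = refl
alternating-2-3 (suc l) = step (alternating-0-1 l) (alternating-1-2 l) (alternating-2-3 l)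
  where
  step : ∀ {x₁ y₂ w₃} → x₁ ≡ l → y₂ ≡ l * l → 6 * w₃ + (3 * (l * l) + l) ≡ 4 * (l * l * l) →
         6 * ((x₁ + y₂) + (y₂ + w₃)) + (3 * (suc l * suc l) + suc l) ≡ 4 * (suc l * suc l * suc l)
  step {w₃ = w₃} refl refl ih = begin
    6 * ((l + l * l) + (l * l + w₃)) + (3 * (suc l * suc l) + suc l)
      ≡⟨ solve (l List.∷ w₃ List.∷ List.[]) ⟩
    (6 * w₃ + (3 * (l * l) + l)) + (12 * (l * l) + 12 * l + 4)
      ≡⟨ cong (_+ (12 * (l * l) + 12 * l + 4)) ih ⟩
    4 * (l * l * l) + (12 * (l * l) + 12 * l + 4)
      ≡⟨ solve (l List.∷ List.[]) ⟩
    4 * (suc l * suc l * suc l) ∎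

alternating-2-4 : ∀ l → 6 * countZerosBeyond 2 (alternating l) 4 + 3 * (l * l * l) ≡ l * l * l * l + 2 * (l * l)
alternating-2-4 zero    = refl
alternating-2-4 (suc l) =
  step {countZerosBeyond 0 A 2} {countZerosBeyond 1 A 3} (alternating-0-2 l) (alternating-1-3 l) (alternating-2-4 l)
  where
  A = alternating l
  step : ∀ {x₂ y₃ w₄} → 2 * x₂ + l ≡ l * l → 6 * y₃ + 3 * (l * l) ≡ 2 * (l * l * l) + l →
         6 * w₄ + 3 * (l * l * l) ≡ l * l * l * l + 2 * (l * l) →
         6 * ((x₂ + y₃) + (y₃ + w₄)) + 3 * (suc l * suc l * suc l) ≡ suc l * suc l * suc l * suc l + 2 * (suc l * suc l)
  step {x₂} {y₃} {w₄} ih₂ ih₃ ih₄ = +-cancelʳ-≡ (3 * l + 6 * (l * l) + 3 * (l * l * l)) _ _ (begin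
    6 * ((x₂ + y₃) + (y₃ + w₄)) + 3 * (suc l * suc l * suc l) + (3 * l + 6 * (l * l) + 3 * (l * l * l))
      ≡⟨ solve (l List.∷ x₂ List.∷ y₃ List.∷ w₄ List.∷ List.[]) ⟩
    3 * (2 * x₂ + l) + 2 * (6 * y₃ + 3 * (l * l)) + (6 * w₄ + 3 * (l * l * l)) + 3 * (suc l * suc l * suc l)
      ≡⟨ cong₃ ih₂ ih₃ ih₄ ⟩
    3 * (l * l) + 2 * (2 * (l * l * l) + l) + (l * l * l * l + 2 * (l * l)) + 3 * (suc l * suc l * suc l)
      ≡⟨ solve (l List.∷ List.[]) ⟩
    suc l * suc l * suc l * suc l + 2 * (suc l * suc l) + (3 * l + 6 * (l * l) + 3 * (l * l * l)) ∎)
    where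
    cong₃ : ∀ {a a′ b b′ c c′} → a ≡ a′ → b ≡ b′ → c ≡ c′ →
            3 * a + 2 * b + c + 3 * (suc l * suc l * suc l) ≡ 3 * a′ + 2 * b′ + c′ + 3 * (suc l * suc l * suc l)
    cong₃ refl refl refl = refl

antiCoeff-even : ∀ k t → antiCoeff (2 * suc k) (suc t) ≡ countZerosBeyond 2 (alternating (suc k)) (suc t)
antiCoeff-even k t = trans (indepCoeff≡countZerosBeyond (antiBit (2 * suc k)) (suc t))
                           (cong (λ bs → countZerosBeyond 2 bs (suc t)) (tabulate-antiBit k))

cubic-∸-form : ∀ n w → 6 * w + (3 * (n * n) + n) ≡ 4 * (n * n * n) → 6 * w ≡ n * (n ∸ 1) * (4 * n + 1)
cubic-∸-form zero      w eq = +-cancelʳ-≡ 0 _ _ eq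
cubic-∸-form n@(suc k) w eq = +-cancelʳ-≡ (3 * (n * n) + n) _ _ (begin
  6 * w + (3 * (n * n) + n)                     ≡⟨ eq ⟩
  4 * (n * n * n)                               ≡⟨ solve (k List.∷ List.[]) ⟩
  n * k * (4 * n + 1) + (3 * (n * n) + n)       ∎)

quartic-∸-form : ∀ n w → 6 * w + 3 * (n * n * n) ≡ n * n * n * n + 2 * (n * n) → 6 * w ≡ n * n * (n ∸ 1) * (n ∸ 2)
quartic-∸-form zero            w eq = +-cancelʳ-≡ 0 _ _ eq
quartic-∸-form (suc zero)      w eq = +-cancelʳ-≡ 3 _ _ eq
quartic-∸-form n@(suc (suc j)) w eq = +-cancelʳ-≡ (3 * (n * n * n)) _ _ (begin
  6 * w + 3 * (n * n * n)                       ≡⟨ eq ⟩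
  n * n * n * n + 2 * (n * n)                   ≡⟨ solve (j List.∷ List.[]) ⟩
  n * n * suc j * j + 3 * (n * n * n)           ∎)

lemma3p1 : (n : ℕ) → n ≥ 1 →
    (6 * antiCoeff (2 * n) 3 ≡ n * (n ∸ 1) * (4 * n + 1))
    × (6 * antiCoeff (2 * n) 4 ≡ n * n * (n ∸ 1) * (n ∸ 2))
lemma3p1 zero ()
lemma3p1 n@(suc k) _ =
  trans (cong (6 *_) (antiCoeff-even k 2)) (cubic-∸-form n (countZerosBeyond 2 (alternating n) 3) (alternating-2-3 n)) ,
  trans (cong (6 *_) (antiCoeff-even k 3)) (quartic-∸-form n (countZerosBeyond 2 (alternating n) 4) (alternating-2-4 n))
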